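{- Let $G$ be a connected cograph and let $S,T\subseteq V(G)$ be disjoint separators of $G$. Then $S\cup T=V(G)$.
   Context: A cograph is a finite simple graph with no induced subgraph isomorphic to the path on four vertices. A separator of a connected graph $G$ is a vertex set $S\subseteq V(G)$ such that $G-S$ (the subgraph induced by $V(G)\setminus S$) is disconnected. -}

module Defs where

open import Data.Nat using (ℕ; suc)
open import Data.Fin using (Fin)
open import Data.Fin.Subset using (Subset; _∈_; _∉_; Empty)
open import Data.Bool using (Bool; true; false)
open import Data.Product using (Σ; _×_; ∃-syntax; _,_)
open import Data.Sum using (_⊎_)
open import Relation.Nullary using (¬_)
open import Relation.Binary.PropositionalEquality using (_≡_; _≢_)

record Graph (n : ℕ) : Set where
  field
    adj   : Fin n → Fin n → Bool
    sym   : ∀ u v → adj u v ≡ adj v u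
    irrefl : ∀ v → adj v v ≡ false

open Graph public

Adj : ∀ {n} → Graph n → Fin n → Fin n → Set
Adj G u v = adj G u v ≡ true

-- A walk from u to v all of whose vertices lie in U (a walk in G[U]).
data WalkIn {n} (G : Graph n) (U : Fin n → Set) : Fin n → Fin n → Set where
  here : ∀ {v} → U v → WalkIn G U v v
  step : ∀ {u w v} → U u → Adj G u w → WalkIn G U w v → WalkIn G U u v

ConnectedOn : ∀ {n} → Graph n → (Fin n → Set) → Set
ConnectedOn G U = (∃[ v ] U v) × (∀ u v → U u → U v → WalkIn G U u v)

Connected : ∀ {n} → Graph n → Set
Connected G = ConnectedOn G (λ _ → Data.Unit.⊤)
  where import Data.Unit

DisconnectedOn : ∀ {n} → Graph n → (Fin n → Set) → Set
DisconnectedOn G U = ∃[ u ] ∃[ v ] (U u × U v × ¬ WalkIn G U u v)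

IsSeparator : ∀ {n} → Graph n → Subset n → Set
IsSeparator G S = DisconnectedOn G (λ v → v ∉ S)

HasInducedP4 : ∀ {n} → Graph n → Set
HasInducedP4 G = ∃[ a ] ∃[ b ] ∃[ c ] ∃[ d ]
  ( a ≢ b × a ≢ c × a ≢ d × b ≢ c × b ≢ d × c ≢ d
  × Adj G a b × Adj G b c × Adj G c d
  × ¬ Adj G a c × ¬ Adj G b d × ¬ Adj G a d )

IsCograph : ∀ {n} → Graph n → Set
IsCograph G = ¬ HasInducedP4 G

Disjoint : ∀ {n} → Subset n → Subset n → Set
Disjoint S T = ∀ v → v ∈ S → v ∉ T

{-# OPTIONS --safe #-}
-- A connected cograph has diameter at most 2: a walk can always be shortcut,
-- since a chordless path of length 3 is an induced P4.  Suppose v ∉ S ∪ T.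
-- As G - S is disconnected, some u ∉ S is cut off from v in G - S, so every
-- common neighbour of u and v lies in S; fix one, c.  Likewise some w is cut
-- off from v in G - T through a common neighbour d ∈ T.  Disjointness puts d
-- outside S and c outside T, whence u ≁ d and w ≁ c.  P4-freeness then forces
-- c ~ d (from u - c - v - d), next u ~ w (from u - c - d - w), and finally
-- u - w - d - v is an induced P4.
module Submission where

open import Defs
open import Data.Nat using (ℕ)
open import Data.Fin using (Fin)
open import Data.Fin.Subset using (Subset; _∈_; _∉_)
open import Data.Fin.Subset.Properties using (_∈?_)
open import Data.Bool.Properties using () renaming (_≟_ to _≟ᵇ_)
open import Data.Sum using (_⊎_; inj₁; inj₂)
open import Data.Product using (_×_; _,_; ∃-syntax)
open import Data.Unit using (tt)
open import Data.Empty using (⊥; ⊥-elim)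
open import Relation.Nullary using (¬_; Dec; yes; no)
import Relation.Binary.PropositionalEquality as ≡
open ≡ using (_≢_)

module _ {n} (G : Graph n) where

  Adj? : ∀ u v → Dec (Adj G u v)
  Adj? u v = adj G u v ≟ᵇ _

  Adj-sym : ∀ {u v} → Adj G u v → Adj G v u
  Adj-sym {u} {v} u~v = ≡.trans (sym G v u) u~v

  Adj-irrefl : ∀ {v} → ¬ Adj G v v
  Adj-irrefl {v} v~v with ≡.trans (≡.sym v~v) (irrefl G v)
  ... | ()

  Adj⇒≢ : ∀ {u v} → Adj G u v → u ≢ v
  Adj⇒≢ u~v ≡.refl = Adj-irrefl u~v

  WalkIn-source : ∀ {U u v} → WalkIn G U u v → U u
  WalkIn-source (here u∈U)     = u∈U
  WalkIn-source (step u∈U _ _) = u∈U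

  WalkIn-++ : ∀ {U u v w} → WalkIn G U u v → WalkIn G U v w → WalkIn G U u w
  WalkIn-++ (here _)            q = q
  WalkIn-++ (step u∈U u~x x⇝v) q = step u∈U u~x (WalkIn-++ x⇝v q)

  WalkIn-reverse : ∀ {U u v} → WalkIn G U u v → WalkIn G U v u
  WalkIn-reverse (here u∈U)            = here u∈U
  WalkIn-reverse (step u∈U u~x x⇝v) =
    WalkIn-++ (WalkIn-reverse x⇝v) (step (WalkIn-source x⇝v) (Adj-sym u~x) (here u∈U))

  induced-P4 : ∀ {a b c d} → Adj G a b → Adj G b c → Adj G c d →
    ¬ Adj G a c → ¬ Adj G b d → ¬ Adj G a d → HasInducedP4 G
  induced-P4 {a} {b} {c} {d} a~b b~c c~d a≁c b≁d a≁d =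
    a , b , c , d
    , Adj⇒≢ a~b , (λ { ≡.refl → a≁d c~d }) , (λ { ≡.refl → a≁c (Adj-sym c~d) })
    , Adj⇒≢ b~c , (λ { ≡.refl → a≁d a~b }) , Adj⇒≢ c~d
    , a~b , b~c , c~d , a≁c , b≁d , a≁d

  cograph-chord : IsCograph G → ∀ {a b c d} → Adj G a b → Adj G b c → Adj G c d →
    Adj G a c ⊎ Adj G b d ⊎ Adj G a d
  cograph-chord cog {a} {b} {c} {d} a~b b~c c~d with Adj? a c | Adj? b d | Adj? a d
  ... | yes a~c | _       | _       = inj₁ a~c
  ... | no _    | yes b~d | _       = inj₂ (inj₁ b~d)
  ... | no _    | no _    | yes a~d = inj₂ (inj₂ a~d)
  ... | no a≁c  | no b≁d  | no a≁d  = ⊥-elim (cog (induced-P4 a~b b~c c~d a≁c b≁d a≁d))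

  data Dist≤2 (u : Fin n) : Fin n → Set where
    dist0 : Dist≤2 u u
    dist1 : ∀ {v} → Adj G u v → Dist≤2 u v
    dist2 : ∀ {c v} → Adj G u c → Adj G c v → Dist≤2 u v

  cograph-walk⇒Dist≤2 : IsCograph G → ∀ {U u v} → WalkIn G U u v → Dist≤2 u v
  cograph-walk⇒Dist≤2 cog (here _) = dist0
  cograph-walk⇒Dist≤2 cog (step _ u~x x⇝v) with cograph-walk⇒Dist≤2 cog x⇝v
  ... | dist0 = dist1 u~x
  ... | dist1 x~v = dist2 u~x x~v
  ... | dist2 x~c c~v with cograph-chord cog u~x x~c c~v
  ...   | inj₁ u~c        = dist2 u~c c~v
  ...   | inj₂ (inj₁ x~v) = dist2 u~x x~v
  ...   | inj₂ (inj₂ u~v) = dist1 u~v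

  connected-cograph-diameter≤2 : Connected G → IsCograph G → ∀ u v → Dist≤2 u v
  connected-cograph-diameter≤2 (_ , walk) cog u v = cograph-walk⇒Dist≤2 cog (walk u v tt tt)

  Separates : Subset n → Fin n → Fin n → Set
  Separates S v u = v ∉ S × u ∉ S × ¬ WalkIn G (_∉ S) v u

  -- Reachability is not decided here, so a vertex cut off from v is only
  -- obtained under double negation; that suffices since the goal is ⊥.
  separator-separates : ∀ {S} → IsSeparator G S → ∀ {v} → v ∉ S →
    ¬ ¬ (∃[ u ] Separates S v u)
  separator-separates (x , y , x∉S , y∉S , x↛y) v∉S k =
    k (x , v∉S , x∉S , λ v⇝x →
      k (y , v∉S , y∉S , λ v⇝y → x↛y (WalkIn-++ (WalkIn-reverse v⇝x) v⇝y)))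

  Separates⇒¬Adj : ∀ {S v u} → Separates S v u → ¬ Adj G v u
  Separates⇒¬Adj (v∉S , u∉S , v↛u) v~u = v↛u (step v∉S v~u (here u∉S))

  Separates-step : ∀ {S v u d} → Separates S v u → d ∉ S → Adj G v d → Separates S d u
  Separates-step (v∉S , u∉S , v↛u) d∉S v~d = d∉S , u∉S , λ d⇝u → v↛u (step v∉S v~d d⇝u)

  Separates⇒common-neighbour : Connected G → IsCograph G → ∀ {S v u} → Separates S v u →
    ∃[ c ] c ∈ S × Adj G v c × Adj G c u
  Separates⇒common-neighbour conn cog {S} {v} {u} S∣vu@(v∉S , u∉S , v↛u)
    with connected-cograph-diameter≤2 conn cog v u
  ... | dist0 = ⊥-elim (v↛u (here v∉S))
  ... | dist1 v~u = ⊥-elim (Separates⇒¬Adj S∣vu v~u)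
  ... | dist2 {c} v~c c~u with c ∈? S
  ...   | yes c∈S = c , c∈S , v~c , c~u
  ...   | no c∉S  = ⊥-elim (v↛u (step v∉S v~c (step c∉S c~u (here u∉S))))

  disjoint-sets-cannot-both-separate : Connected G → IsCograph G →
    ∀ {S T} → Disjoint S T → ∀ {v u w} → Separates S v u → Separates T v w → ⊥
  disjoint-sets-cannot-both-separate conn cog disj {v} {u} {w} S∣vu T∣vw
    with Separates⇒common-neighbour conn cog S∣vu | Separates⇒common-neighbour conn cog T∣vw
  ... | c , c∈S , v~c , c~u | d , d∈T , v~d , d~w =
    cog (induced-P4 u~w (Adj-sym d~w) (Adj-sym v~d) u≁d w≁v u≁v)
    where
    u≁v : ¬ Adj G u v
    u≁v u~v = Separates⇒¬Adj S∣vu (Adj-sym u~v)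

    w≁v : ¬ Adj G w v
    w≁v w~v = Separates⇒¬Adj T∣vw (Adj-sym w~v)

    u≁d : ¬ Adj G u d
    u≁d u~d = Separates⇒¬Adj (Separates-step S∣vu (λ d∈S → disj d d∈S d∈T) v~d) (Adj-sym u~d)

    c≁w : ¬ Adj G c w
    c≁w = Separates⇒¬Adj (Separates-step T∣vw (disj c c∈S) v~c)

    c~d : Adj G c d
    c~d with cograph-chord cog (Adj-sym c~u) (Adj-sym v~c) v~d
    ... | inj₁ u~v        = ⊥-elim (u≁v u~v)
    ... | inj₂ (inj₁ c~d) = c~d
    ... | inj₂ (inj₂ u~d) = ⊥-elim (u≁d u~d)

    u~w : Adj G u w
    u~w with cograph-chord cog (Adj-sym c~u) c~d d~w
    ... | inj₁ u~d        = ⊥-elim (u≁d u~d)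
    ... | inj₂ (inj₁ c~w) = ⊥-elim (c≁w c~w)
    ... | inj₂ (inj₂ u~w) = u~w

mainTheorem9 : (n : ℕ) (G : Graph n) → Connected G → IsCograph G →
    (S T : Subset n) → Disjoint S T → IsSeparator G S → IsSeparator G T →
    ∀ (v : Fin n) → v ∈ S ⊎ v ∈ T
mainTheorem9 n G conn cog S T disj sepS sepT v with v ∈? S | v ∈? T
... | yes v∈S | _       = inj₁ v∈S
... | no _    | yes v∈T = inj₂ v∈T
... | no v∉S  | no v∉T  =
  ⊥-elim (separator-separates G sepS v∉S λ (u , S∣vu) →
          separator-separates G sepT v∉T λ (w , T∣vw) →
          disjoint-sets-cannot-both-separate G conn cog disj S∣vu T∣vw)
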